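{- Let $B_n$ be the Bernoulli numbers and $E_k$ the Euler numbers (defined by $\frac{2e^{t/2}}{e^t+1}=\sum_{k\ge0}\frac{E_k}{2^k}\frac{t^k}{k!}$, i.e. $E_k=2^kE_k(1/2)$ with $E_k(x)$ the Euler polynomials given by $\frac{2e^{xt}}{e^t+1}=\sum_{n\ge0}E_n(x)\frac{t^n}{n!}$). For every integer $n>0$, $$-\frac{1}{2n}(1-3^{1-2n})(2^{2n}-1)B_{2n}=\sum_{m=0}^{n-1}\binom{2n-1}{2m}\frac{E_{2m}}{2^{2m}}\Big(-\frac16\Big)^{2(n-m)-1}.$$ -}

module Defs where

open import Data.Nat using (ℕ; zero; suc; _+_; _*_; _∸_)
open import Data.Nat.Combinatorics using (_C_)
open import Data.Integer using (+_)
open import Data.List using (List; []; _∷_; _++_; [_])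
open import Data.Rational using (ℚ; 0ℚ; 1ℚ; ½; _/_; -_) renaming (_+_ to _+ℚ_; _*_ to _*ℚ_; _-_ to _-ℚ_)

ℕ→ℚ : ℕ → ℚ
ℕ→ℚ n = (+ n) / 1

-- 1/d for d > 0 (returns 0 for d = 0; only used with d > 0)
recip : ℕ → ℚ
recip zero = 0ℚ
recip (suc d) = (+ 1) / suc d

pow : ℚ → ℕ → ℚ
pow q zero = 1ℚ
pow q (suc k) = q *ℚ pow q k

nth : ℕ → List ℚ → ℚ
nth _ [] = 0ℚ
nth zero (x ∷ _) = x
nth (suc i) (_ ∷ xs) = nth i xs

wsum : ℕ → ℕ → List ℚ → ℚ
wsum N k [] = 0ℚ
wsum N k (b ∷ bs) = (ℕ→ℚ (N C k) *ℚ b) +ℚ wsum N (suc k) bs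

-- Bernoulli numbers, from t/(e^t - 1) = Σ B_n t^n/n!, i.e.
-- B_0 = 1 and Σ_{k=0}^{m} C(m+1,k) B_k = 0 for m ≥ 1.
-- bernoulliUpTo m = [B_0, ..., B_m]
bernoulliUpTo : ℕ → List ℚ
bernoulliUpTo zero = [ 1ℚ ]
bernoulliUpTo (suc m) =
  let bs = bernoulliUpTo m in
  bs ++ [ - (recip (suc (suc m)) *ℚ wsum (suc (suc m)) 0 bs) ]

bernoulli : ℕ → ℚ
bernoulli n = nth n (bernoulliUpTo n)

-- Euler polynomials evaluated at x, from 2e^{xt}/(e^t+1) = Σ E_n(x) t^n/n!,
-- i.e. comparing coefficients of t^n/n! in (e^t + 1) Σ E_k(x) t^k/k! = 2 e^{xt}:
-- Σ_{k=0}^{n} C(n,k) E_k(x) + E_n(x) = 2 x^n,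
-- so E_n(x) = x^n - ½ Σ_{k<n} C(n,k) E_k(x).
-- eulerPolyUpTo n x = [E_0(x), ..., E_n(x)]
eulerPolyUpTo : ℕ → ℚ → List ℚ
eulerPolyUpTo zero x = [ 1ℚ ]
eulerPolyUpTo (suc n) x =
  let es = eulerPolyUpTo n x in
  es ++ [ pow x (suc n) -ℚ (½ *ℚ wsum (suc n) 0 es) ]

eulerPoly : ℕ → ℚ → ℚ
eulerPoly n x = nth n (eulerPolyUpTo n x)

euler : ℕ → ℚ
euler k = pow (ℕ→ℚ 2) k *ℚ eulerPoly k ½

sumBelow : ℕ → (ℕ → ℚ) → ℚ
sumBelow zero f = 0ℚ
sumBelow (suc n) f = sumBelow n f +ℚ f n

module Submission where

-- A sequence a : ℕ → ℚ is read as the exponential generating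
-- function A(t) = Σ aₙ tⁿ/n!, and the operations needed on such series are
-- defined directly on coefficients: multiplication by e^{ct} (expMul),
-- by t (tMul) and the substitution t ↦ ct (rescale).  Their algebraic laws
-- (linearity, e^{ct}e^{dt} = e^{(c+d)t}, e^{0t} = 1, ...) are proved by
-- induction, and two cancellation lemmas say that the factors e^{ct} - 1
-- (c ≠ 0) and e^t + 1 may be cancelled.  The recursive definitions of
-- Defs then say that B(t)(e^t - 1) = t and E_x(t)(e^t + 1) = 2e^{xt}.
-- From these we derive, by cancellation, the multiplication formula
-- B(ct) = (c/2) Σ_{j<n} e^{jct} B(2t) for nc = 2, the identity
-- t·E_{1/3}(t) = (e^{4t/3} - e^{t/3}) B(2t), the parity of E_{1/2} and the
-- shift E_{1/3}(t) = e^{-t/6} E_{1/2}(t).  Comparing coefficients of t^{2n}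
-- gives -(1 - 3^{1-2n})(2^{2n} - 1) B_{2n} = 2n E_{2n-1}(1/3), and the
-- shift, read through the binomial closed form of expMul, expands
-- E_{2n-1}(1/3) into the sum of the theorem.

open import Defs

module Lemmas where

  open import Data.Nat as ℕ using (ℕ; zero; suc; _∸_; s≤s; z≤n)
  import Data.Nat.Properties as ℕP
  open import Data.Nat.Combinatorics using (_C_; nCk+nC[k+1]≡[n+1]C[k+1]; k>n⇒nCk≡0; nCn≡1; nC1≡n; nCk≡nC[n∸k])
  open import Data.Nat.Divisibility using (∣1⇒≡1)
  open import Data.Nat.Coprimality using (Coprime; 1-coprimeTo)
  import Data.Integer as ℤ
  import Data.Integer.Properties as ℤP
  open import Data.List using (List; []; _∷_; _++_; [_]; length)
  import Data.List.Properties as ListP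
  open import Data.Rational hiding (truncate)
  open import Data.Rational.Properties
  open import Data.Product using (_,_)
  open import Data.Sum using (inj₁; inj₂)
  open import Data.Maybe using (Maybe; just; nothing)
  open import Relation.Nullary using (yes; no)
  open import Relation.Binary.PropositionalEquality hiding ([_])
  open import Function using (_∘′_)
  open import Data.Nat.Induction using (<-rec)
  open import Algebra.Properties.Group +-0-group using (x∙y⁻¹≈ε⇒x≈y)
  open import Tactic.RingSolver using (solve-∀)
  open import Tactic.RingSolver.Core.AlmostCommutativeRing using (AlmostCommutativeRing; fromCommutativeRing)
  open ≡-Reasoning

  ℚ-ring : AlmostCommutativeRing _ _
  ℚ-ring = fromCommutativeRing +-*-commutativeRing isZero
    where
    isZero : ∀ x → Maybe (0ℚ ≡ x)
    isZero x with 0ℚ ≟ x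
    ... | yes p = just p
    ... | no _ = nothing

  coprime-1 : ∀ m → Coprime m 1
  coprime-1 m (_ , d∣1) = ∣1⇒≡1 d∣1

  ℕ→ℚ-mkℚ : ∀ n → ℕ→ℚ n ≡ mkℚ (ℤ.+ n) 0 (coprime-1 n)
  ℕ→ℚ-mkℚ n = normalize-coprime (coprime-1 n)

  ℕ→ℚ-suc : ∀ n → ℕ→ℚ (suc n) ≡ 1ℚ + ℕ→ℚ n
  ℕ→ℚ-suc n rewrite ℕ→ℚ-mkℚ n =
    sym (trans unfold (/-cong {p₁ = (ℤ.+ 1) ℤ.+ ((ℤ.+ n) ℤ.* (ℤ.+ 1))} {q₁ = 1} {p₂ = ℤ.+ suc n} {q₂ = 1}
                              (cong (ℤ._+_ (ℤ.+ 1)) (ℤP.*-identityʳ (ℤ.+ n))) refl))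
    where
    unfold : 1ℚ + mkℚ (ℤ.+ n) 0 (coprime-1 n) ≡ ((ℤ.+ 1) ℤ.+ ((ℤ.+ n) ℤ.* (ℤ.+ 1))) / 1
    unfold = refl

  ℕ→ℚ-+ : ∀ m n → ℕ→ℚ (m ℕ.+ n) ≡ ℕ→ℚ m + ℕ→ℚ n
  ℕ→ℚ-+ zero n = sym (+-identityˡ (ℕ→ℚ n))
  ℕ→ℚ-+ (suc m) n = begin
    ℕ→ℚ (suc (m ℕ.+ n))      ≡⟨ ℕ→ℚ-suc (m ℕ.+ n) ⟩
    1ℚ + ℕ→ℚ (m ℕ.+ n)       ≡⟨ cong (_+_ 1ℚ) (ℕ→ℚ-+ m n) ⟩
    1ℚ + (ℕ→ℚ m + ℕ→ℚ n)     ≡⟨ +-assoc 1ℚ (ℕ→ℚ m) (ℕ→ℚ n) ⟨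
    (1ℚ + ℕ→ℚ m) + ℕ→ℚ n     ≡⟨ cong (_+ ℕ→ℚ n) (ℕ→ℚ-suc m) ⟨
    ℕ→ℚ (suc m) + ℕ→ℚ n      ∎

  ℕ→ℚ-* : ∀ m n → ℕ→ℚ (m ℕ.* n) ≡ ℕ→ℚ m * ℕ→ℚ n
  ℕ→ℚ-* zero n = sym (*-zeroˡ (ℕ→ℚ n))
  ℕ→ℚ-* (suc m) n = begin
    ℕ→ℚ (n ℕ.+ m ℕ.* n)       ≡⟨ ℕ→ℚ-+ n (m ℕ.* n) ⟩
    ℕ→ℚ n + ℕ→ℚ (m ℕ.* n)     ≡⟨ cong (_+_ (ℕ→ℚ n)) (ℕ→ℚ-* m n) ⟩
    ℕ→ℚ n + ℕ→ℚ m * ℕ→ℚ n     ≡⟨ factor (ℕ→ℚ n) (ℕ→ℚ m) ⟩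
    (1ℚ + ℕ→ℚ m) * ℕ→ℚ n      ≡⟨ cong (_* ℕ→ℚ n) (ℕ→ℚ-suc m) ⟨
    ℕ→ℚ (suc m) * ℕ→ℚ n       ∎
    where
    factor : ∀ a b → a + b * a ≡ (1ℚ + b) * a
    factor = solve-∀ ℚ-ring

  ℕ→ℚ-^ : ∀ m k → ℕ→ℚ (m ℕ.^ k) ≡ pow (ℕ→ℚ m) k
  ℕ→ℚ-^ m zero = refl
  ℕ→ℚ-^ m (suc k) = trans (ℕ→ℚ-* m (m ℕ.^ k)) (cong (ℕ→ℚ m *_) (ℕ→ℚ-^ m k))

  recip-inverse : ∀ x → 0 ℕ.< x → recip x * ℕ→ℚ x ≡ 1ℚ
  recip-inverse (suc d) _ rewrite ℕ→ℚ-mkℚ (suc d) | normalize-coprime {1} {d} (1-coprimeTo (suc d)) =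
    *-inverseˡ (mkℚ (ℤ.+ suc d) 0 (coprime-1 (suc d)))

  ℕ→ℚ-suc≢0 : ∀ n → ℕ→ℚ (suc n) ≢ 0ℚ
  ℕ→ℚ-suc≢0 n eq with trans (sym (recip-inverse (suc n) (s≤s z≤n))) (trans (cong (recip (suc n) *_) eq) (*-zeroʳ (recip (suc n))))
  ... | ()

  zero-product : ∀ p q → p ≢ 0ℚ → p * q ≡ 0ℚ → q ≡ 0ℚ
  zero-product p q p≢0 pq≡0 = begin
    q                ≡⟨ *-identityˡ q ⟨
    1ℚ * q           ≡⟨ cong (_* q) (*-inverseˡ p) ⟨
    (1/ p * p) * q   ≡⟨ *-assoc (1/ p) p q ⟩
    1/ p * (p * q)   ≡⟨ cong (1/ p *_) pq≡0 ⟩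
    1/ p * 0ℚ        ≡⟨ *-zeroʳ (1/ p) ⟩
    0ℚ               ∎
    where instance _ = ≢-nonZero p≢0

  double-zero : ∀ x → x + x ≡ 0ℚ → x ≡ 0ℚ
  double-zero x x+x≡0 = zero-product (ℕ→ℚ 2) x (ℕ→ℚ-suc≢0 1) (trans (doubling x) x+x≡0)
    where
    doubling : ∀ x → (1ℚ + 1ℚ) * x ≡ x + x
    doubling = solve-∀ ℚ-ring

  inverse-unique : ∀ x y s → x * s ≡ 1ℚ → y * s ≡ 1ℚ → x ≡ y
  inverse-unique x y s xs≡1 ys≡1 = begin
    x              ≡⟨ *-identityʳ x ⟨
    x * 1ℚ         ≡⟨ cong (x *_) ys≡1 ⟨
    x * (y * s)    ≡⟨ swap x y s ⟩
    y * (x * s)    ≡⟨ cong (y *_) xs≡1 ⟩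
    y * 1ℚ         ≡⟨ *-identityʳ y ⟩
    y              ∎
    where
    swap : ∀ x y s → x * (y * s) ≡ y * (x * s)
    swap = solve-∀ ℚ-ring

  pow-1ℚ : ∀ k → pow 1ℚ k ≡ 1ℚ
  pow-1ℚ zero = refl
  pow-1ℚ (suc k) = cong (1ℚ *_) (pow-1ℚ k)

  pow-* : ∀ a b k → pow (a * b) k ≡ pow a k * pow b k
  pow-* a b zero = refl
  pow-* a b (suc k) = trans (cong ((a * b) *_) (pow-* a b k)) (regroup a b (pow a k) (pow b k))
    where
    regroup : ∀ a b x y → (a * b) * (x * y) ≡ (a * x) * (b * y)
    regroup = solve-∀ ℚ-ring

  pow-even : ∀ m → pow (- 1ℚ) (2 ℕ.* m) ≡ 1ℚ
  pow-even zero = refl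
  pow-even (suc m) = trans (cong (pow (- 1ℚ)) (ℕP.*-suc 2 m)) (cong (λ z → - 1ℚ * (- 1ℚ * z)) (pow-even m))

  recip-pow-inverse : ∀ m k → recip (suc m ℕ.^ k) * pow (ℕ→ℚ (suc m)) k ≡ 1ℚ
  recip-pow-inverse m k =
    trans (cong (recip (suc m ℕ.^ k) *_) (sym (ℕ→ℚ-^ (suc m) k))) (recip-inverse (suc m ℕ.^ k) (ℕP.m^n>0 (suc m) k))

  recip-pow : ∀ m k → recip (suc m ℕ.^ k) ≡ pow (recip (suc m)) k
  recip-pow m k = inverse-unique _ _ (pow (ℕ→ℚ (suc m)) k) (recip-pow-inverse m k) (begin
    pow (recip (suc m)) k * pow (ℕ→ℚ (suc m)) k  ≡⟨ pow-* (recip (suc m)) (ℕ→ℚ (suc m)) k ⟨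
    pow (recip (suc m) * ℕ→ℚ (suc m)) k          ≡⟨ cong (λ z → pow z k) (recip-inverse (suc m) (s≤s z≤n)) ⟩
    pow 1ℚ k                                      ≡⟨ pow-1ℚ k ⟩
    1ℚ                                            ∎)

  sum-cong : ∀ n (f g : ℕ → ℚ) → (∀ k → k ℕ.< n → f k ≡ g k) → sumBelow n f ≡ sumBelow n g
  sum-cong zero f g f≡g = refl
  sum-cong (suc n) f g f≡g = cong₂ _+_ (sum-cong n f g (λ k k<n → f≡g k (ℕP.m<n⇒m<1+n k<n))) (f≡g n ℕP.≤-refl)

  sum-first : ∀ n (f : ℕ → ℚ) → sumBelow (suc n) f ≡ f 0 + sumBelow n (λ k → f (suc k))
  sum-first zero f = trans (+-identityˡ (f 0)) (sym (+-identityʳ (f 0)))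
  sum-first (suc n) f = trans (cong (_+ f (suc n)) (sum-first n f)) (+-assoc (f 0) _ _)

  sum-+ : ∀ n (f g : ℕ → ℚ) → sumBelow n (λ k → f k + g k) ≡ sumBelow n f + sumBelow n g
  sum-+ zero f g = refl
  sum-+ (suc n) f g =
    trans (cong (_+ (f n + g n)) (sum-+ n f g)) (regroup (sumBelow n f) (sumBelow n g) (f n) (g n))
    where
    regroup : ∀ a b c d → (a + b) + (c + d) ≡ (a + c) + (b + d)
    regroup = solve-∀ ℚ-ring

  sum-scale : ∀ n c (f : ℕ → ℚ) → c * sumBelow n f ≡ sumBelow n (λ k → c * f k)
  sum-scale zero c f = *-zeroʳ c
  sum-scale (suc n) c f = trans (*-distribˡ-+ c (sumBelow n f) (f n)) (cong (_+ c * f n) (sum-scale n c f))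

  sum-evens : ∀ n (f : ℕ → ℚ) → (∀ m → f (suc (2 ℕ.* m)) ≡ 0ℚ) → sumBelow (2 ℕ.* n) f ≡ sumBelow n (λ m → f (2 ℕ.* m))
  sum-evens zero f odd≡0 = refl
  sum-evens (suc n) f odd≡0 = begin
    sumBelow (2 ℕ.* suc n) f                             ≡⟨ cong (λ m → sumBelow m f) (ℕP.*-suc 2 n) ⟩
    sumBelow (2 ℕ.* n) f + f (2 ℕ.* n) + f (suc (2 ℕ.* n)) ≡⟨ cong (_+_ (sumBelow (2 ℕ.* n) f + f (2 ℕ.* n))) (odd≡0 n) ⟩
    sumBelow (2 ℕ.* n) f + f (2 ℕ.* n) + 0ℚ             ≡⟨ +-identityʳ _ ⟩
    sumBelow (2 ℕ.* n) f + f (2 ℕ.* n)                   ≡⟨ cong (_+ f (2 ℕ.* n)) (sum-evens n f odd≡0) ⟩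
    sumBelow n (λ m → f (2 ℕ.* m)) + f (2 ℕ.* n)         ∎

  sum-telescope : ∀ n (f : ℕ → ℚ) → sumBelow n (λ j → f (suc j)) - sumBelow n f ≡ f n - f 0
  sum-telescope zero f = empty (f 0)
    where
    empty : ∀ x → 0ℚ - 0ℚ ≡ x - x
    empty = solve-∀ ℚ-ring
  sum-telescope (suc n) f = begin
    (sumBelow n (λ j → f (suc j)) + f (suc n)) - (sumBelow n f + f n)
      ≡⟨ regroup (sumBelow n (λ j → f (suc j))) (sumBelow n f) (f n) (f (suc n)) ⟩
    (sumBelow n (λ j → f (suc j)) - sumBelow n f) + (f (suc n) - f n)
      ≡⟨ cong (_+ (f (suc n) - f n)) (sum-telescope n f) ⟩
    (f n - f 0) + (f (suc n) - f n)
      ≡⟨ cancel (f n) (f (suc n)) (f 0) ⟩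
    f (suc n) - f 0 ∎
    where
    regroup : ∀ S′ S a b → (S′ + b) - (S + a) ≡ (S′ - S) + (b - a)
    regroup = solve-∀ ℚ-ring
    cancel : ∀ a b z → (a - z) + (b - a) ≡ b - z
    cancel = solve-∀ ℚ-ring

  -- Exponential generating functions.  A sequence a stands for the series
  -- A(t) = Σ aₙ tⁿ/n!, and shift a for its derivative A'(t).
  Seq : Set
  Seq = ℕ → ℚ

  shift : Seq → Seq
  shift a k = a (suc k)

  one : Seq
  one zero = 1ℚ
  one (suc _) = 0ℚ

  -- expMul c a is e^{ct}·A(t): its constant term is a₀, and its derivative
  -- obeys the product rule (e^{ct}A)' = c·e^{ct}A + e^{ct}A'.
  expMul : ℚ → Seq → Seq
  expMul c a zero = a 0
  expMul c a (suc N) = c * expMul c a N + expMul c (shift a) N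

  expMul-cong : ∀ c (a b : Seq) → (∀ k → a k ≡ b k) → ∀ N → expMul c a N ≡ expMul c b N
  expMul-cong c a b a≡b zero = a≡b 0
  expMul-cong c a b a≡b (suc N) =
    cong₂ (λ x y → c * x + y) (expMul-cong c a b a≡b N) (expMul-cong c (shift a) (shift b) (λ k → a≡b (suc k)) N)

  expMul-scale : ∀ c p (a : Seq) N → expMul c (λ k → p * a k) N ≡ p * expMul c a N
  expMul-scale c p a zero = refl
  expMul-scale c p a (suc N) rewrite expMul-scale c p a N | expMul-scale c p (shift a) N =
    factor c p (expMul c a N) (expMul c (shift a) N)
    where
    factor : ∀ c p x u → c * (p * x) + p * u ≡ p * (c * x + u)
    factor = solve-∀ ℚ-ring

  expMul-+ : ∀ c (a b : Seq) N → expMul c (λ k → a k + b k) N ≡ expMul c a N + expMul c b N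
  expMul-+ c a b zero = refl
  expMul-+ c a b (suc N) rewrite expMul-+ c a b N | expMul-+ c (shift a) (shift b) N =
    regroup c (expMul c a N) (expMul c b N) (expMul c (shift a) N) (expMul c (shift b) N)
    where
    regroup : ∀ c x y u v → c * (x + y) + (u + v) ≡ (c * x + u) + (c * y + v)
    regroup = solve-∀ ℚ-ring

  expMul-- : ∀ c (a b : Seq) N → expMul c (λ k → a k - b k) N ≡ expMul c a N - expMul c b N
  expMul-- c a b zero = refl
  expMul-- c a b (suc N) rewrite expMul-- c a b N | expMul-- c (shift a) (shift b) N =
    regroup c (expMul c a N) (expMul c b N) (expMul c (shift a) N) (expMul c (shift b) N)
    where
    regroup : ∀ c x y u v → c * (x - y) + (u - v) ≡ (c * x + u) - (c * y + v)
    regroup = solve-∀ ℚ-ring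

  expMul-zero : ∀ c N → expMul c (λ _ → 0ℚ) N ≡ 0ℚ
  expMul-zero c zero = refl
  expMul-zero c (suc N) rewrite expMul-zero c N = trans (+-identityʳ (c * 0ℚ)) (*-zeroʳ c)

  expMul-sum : ∀ c n (f : ℕ → Seq) N →
               expMul c (λ k → sumBelow n (λ j → f j k)) N ≡ sumBelow n (λ j → expMul c (f j) N)
  expMul-sum c zero f N = expMul-zero c N
  expMul-sum c (suc n) f N =
    trans (expMul-+ c (λ k → sumBelow n (λ j → f j k)) (f n) N) (cong (_+ expMul c (f n) N) (expMul-sum c n f N))

  expMul-0 : ∀ (a : Seq) N → expMul 0ℚ a N ≡ a N
  expMul-0 a zero = refl
  expMul-0 a (suc N) rewrite expMul-0 (shift a) N =
    trans (cong (_+ a (suc N)) (*-zeroˡ (expMul 0ℚ a N))) (+-identityˡ (a (suc N)))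

  expMul-one : ∀ c N → expMul c one N ≡ pow c N
  expMul-one c zero = refl
  expMul-one c (suc N) rewrite expMul-one c N | expMul-zero c N = +-identityʳ (c * pow c N)

  expMul-expMul : ∀ c d (a : Seq) N → expMul c (expMul d a) N ≡ expMul (c + d) a N
  expMul-expMul c d a zero = refl
  expMul-expMul c d a (suc N) = begin
    c * expMul c (expMul d a) N + expMul c (λ k → d * expMul d a k + expMul d (shift a) k) N
      ≡⟨ cong (λ z → c * expMul c (expMul d a) N + z) (expMul-+ c (λ k → d * expMul d a k) (expMul d (shift a)) N) ⟩
    c * expMul c (expMul d a) N + (expMul c (λ k → d * expMul d a k) N + expMul c (expMul d (shift a)) N)
      ≡⟨ cong (λ z → c * expMul c (expMul d a) N + (z + expMul c (expMul d (shift a)) N)) (expMul-scale c d (expMul d a) N) ⟩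
    c * expMul c (expMul d a) N + (d * expMul c (expMul d a) N + expMul c (expMul d (shift a)) N)
      ≡⟨ cong₂ (λ x y → c * x + (d * x + y)) (expMul-expMul c d a N) (expMul-expMul c d (shift a) N) ⟩
    c * expMul (c + d) a N + (d * expMul (c + d) a N + expMul (c + d) (shift a) N)
      ≡⟨ collect c d (expMul (c + d) a N) (expMul (c + d) (shift a) N) ⟩
    (c + d) * expMul (c + d) a N + expMul (c + d) (shift a) N ∎
    where
    collect : ∀ c d x y → c * x + (d * x + y) ≡ (c + d) * x + y
    collect = solve-∀ ℚ-ring

  binomialSum : ℚ → Seq → Seq
  binomialSum c a N = sumBelow (suc N) (λ k → ℕ→ℚ (N C k) * pow c (N ∸ k) * a k)

  -- Pascal's rule shows that binomialSum obeys the recursion defining expMul.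
  binomialSum-step : ∀ c (a : Seq) N → binomialSum c a (suc N) ≡ c * binomialSum c a N + binomialSum c (shift a) N
  binomialSum-step c a N = begin
    binomialSum c a (suc N)
      ≡⟨ sum-first (suc N) term ⟩
    term 0 + sumBelow (suc N) (λ k → term (suc k))
      ≡⟨ cong (_+_ (term 0)) (trans (sum-cong (suc N) _ _ pascal) (sum-+ (suc N) lower upper)) ⟩
    term 0 + (binomialSum c (shift a) N + sumBelow (suc N) upper)
      ≡⟨ cong (λ z → term 0 + (binomialSum c (shift a) N + z)) upper-sum ⟩
    term 0 + (binomialSum c (shift a) N + c * tail)
      ≡⟨ regroup c (pow c N) (a 0) (binomialSum c (shift a) N) tail ⟩
    c * (1ℚ * pow c N * a 0 + tail) + binomialSum c (shift a) N
      ≡⟨ cong (λ z → c * z + binomialSum c (shift a) N) (sum-first N (λ k → ℕ→ℚ (N C k) * pow c (N ∸ k) * a k)) ⟨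
    c * binomialSum c a N + binomialSum c (shift a) N ∎
    where
    term lower upper : ℕ → ℚ
    term k = ℕ→ℚ (suc N C k) * pow c (suc N ∸ k) * a k
    lower k = ℕ→ℚ (N C k) * pow c (N ∸ k) * a (suc k)
    upper k = ℕ→ℚ (N C suc k) * pow c (N ∸ k) * a (suc k)
    tail : ℚ
    tail = sumBelow N (λ k → ℕ→ℚ (N C suc k) * pow c (N ∸ suc k) * a (suc k))

    pascal : ∀ k → k ℕ.< suc N → term (suc k) ≡ lower k + upper k
    pascal k _ rewrite sym (nCk+nC[k+1]≡[n+1]C[k+1] N k) | ℕ→ℚ-+ (N C k) (N C suc k) =
      distrib (ℕ→ℚ (N C k)) (ℕ→ℚ (N C suc k)) (pow c (N ∸ k)) (a (suc k))
      where
      distrib : ∀ x y p z → (x + y) * p * z ≡ x * p * z + y * p * z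
      distrib = solve-∀ ℚ-ring

    upper-last : upper N ≡ 0ℚ
    upper-last rewrite k>n⇒nCk≡0 {N} {suc N} ℕP.≤-refl =
      trans (cong (_* a (suc N)) (*-zeroˡ (pow c (N ∸ N)))) (*-zeroˡ (a (suc N)))

    upper-inner : ∀ k → k ℕ.< N → c * (ℕ→ℚ (N C suc k) * pow c (N ∸ suc k) * a (suc k)) ≡ upper k
    upper-inner k k<N rewrite ℕP.+-∸-assoc 1 k<N =
      absorb c (ℕ→ℚ (N C suc k)) (pow c (N ∸ suc k)) (a (suc k))
      where
      absorb : ∀ c x p y → c * (x * p * y) ≡ x * (c * p) * y
      absorb = solve-∀ ℚ-ring

    upper-sum : sumBelow (suc N) upper ≡ c * tail
    upper-sum = begin
      sumBelow N upper + upper N  ≡⟨ cong (sumBelow N upper +_) upper-last ⟩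
      sumBelow N upper + 0ℚ       ≡⟨ +-identityʳ (sumBelow N upper) ⟩
      sumBelow N upper            ≡⟨ sum-cong N _ _ upper-inner ⟨
      sumBelow N (λ k → c * (ℕ→ℚ (N C suc k) * pow c (N ∸ suc k) * a (suc k)))  ≡⟨ sum-scale N c _ ⟨
      c * tail                    ∎

    regroup : ∀ c p a₀ S T → 1ℚ * (c * p) * a₀ + (S + c * T) ≡ c * (1ℚ * p * a₀ + T) + S
    regroup = solve-∀ ℚ-ring

  expMul-binomial : ∀ c (a : Seq) N → expMul c a N ≡ binomialSum c a N
  expMul-binomial c a zero = sym (trans (+-identityˡ _) (*-identityˡ (a 0)))
  expMul-binomial c a (suc N) =
    trans (cong₂ (λ x y → c * x + y) (expMul-binomial c a N) (expMul-binomial c (shift a) N))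
          (sym (binomialSum-step c a N))

  -- tMul a is t·A(t).
  tMul : Seq → Seq
  tMul a zero = 0ℚ
  tMul a (suc N) = ℕ→ℚ (suc N) * a N

  tMul-cong : ∀ (a b : Seq) → (∀ k → a k ≡ b k) → ∀ N → tMul a N ≡ tMul b N
  tMul-cong a b a≡b zero = refl
  tMul-cong a b a≡b (suc N) = cong (ℕ→ℚ (suc N) *_) (a≡b N)

  tMul-+ : ∀ (a b : Seq) N → tMul (λ k → a k + b k) N ≡ tMul a N + tMul b N
  tMul-+ a b zero = sym (+-identityˡ 0ℚ)
  tMul-+ a b (suc N) = *-distribˡ-+ (ℕ→ℚ (suc N)) (a N) (b N)

  tMul-scale : ∀ p (a : Seq) N → tMul (λ k → p * a k) N ≡ p * tMul a N
  tMul-scale p a zero = sym (*-zeroʳ p)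
  tMul-scale p a (suc N) = swap (ℕ→ℚ (suc N)) p (a N)
    where
    swap : ∀ s p x → s * (p * x) ≡ p * (s * x)
    swap = solve-∀ ℚ-ring

  shift-tMul : ∀ (a : Seq) k → shift (tMul a) k ≡ a k + tMul (shift a) k
  shift-tMul a zero = trans (*-identityˡ (a 0)) (sym (+-identityʳ (a 0)))
  shift-tMul a (suc k) rewrite ℕ→ℚ-suc (suc k) = expand (ℕ→ℚ (suc k)) (a (suc k))
    where
    expand : ∀ s x → (1ℚ + s) * x ≡ x + s * x
    expand = solve-∀ ℚ-ring

  expMul-tMul : ∀ c (a : Seq) N → expMul c (tMul a) N ≡ tMul (expMul c a) N
  expMul-tMul c a zero = refl
  expMul-tMul c a (suc N) = begin
    c * expMul c (tMul a) N + expMul c (shift (tMul a)) N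
      ≡⟨ cong₂ (λ x y → c * x + y) (expMul-tMul c a N) (expMul-cong c _ _ (shift-tMul a) N) ⟩
    c * tMul (expMul c a) N + expMul c (λ k → a k + tMul (shift a) k) N
      ≡⟨ cong (λ y → c * tMul (expMul c a) N + y) (expMul-+ c a (tMul (shift a)) N) ⟩
    c * tMul (expMul c a) N + (expMul c a N + expMul c (tMul (shift a)) N)
      ≡⟨ cong (λ y → c * tMul (expMul c a) N + (expMul c a N + y)) (expMul-tMul c (shift a) N) ⟩
    c * tMul (expMul c a) N + (expMul c a N + tMul (expMul c (shift a)) N)
      ≡⟨ product-rule N ⟩
    ℕ→ℚ (suc N) * expMul c a N ∎
    where
    product-rule : ∀ N → c * tMul (expMul c a) N + (expMul c a N + tMul (expMul c (shift a)) N)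
                         ≡ ℕ→ℚ (suc N) * expMul c a N
    product-rule zero = base c (a 0)
      where
      base : ∀ c x → c * 0ℚ + (x + 0ℚ) ≡ 1ℚ * x
      base = solve-∀ ℚ-ring
    product-rule (suc K) rewrite ℕ→ℚ-suc (suc K) =
      step c (ℕ→ℚ (suc K)) (expMul c a K) (expMul c (shift a) K)
      where
      step : ∀ c s x y → c * (s * x) + ((c * x + y) + s * y) ≡ (1ℚ + s) * (c * x + y)
      step = solve-∀ ℚ-ring

  -- rescale c a is A(ct).
  rescale : ℚ → Seq → Seq
  rescale c a N = pow c N * a N

  rescale-expMul : ∀ c d (a : Seq) N → rescale c (expMul d a) N ≡ expMul (c * d) (rescale c a) N
  rescale-expMul c d a zero = refl
  rescale-expMul c d a (suc N) = sym (begin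
    (c * d) * expMul (c * d) (rescale c a) N + expMul (c * d) (shift (rescale c a)) N
      ≡⟨ cong (λ y → (c * d) * expMul (c * d) (rescale c a) N + y)
              (trans (expMul-cong (c * d) _ _ (λ k → *-assoc c (pow c k) (a (suc k))) N)
                     (expMul-scale (c * d) c (rescale c (shift a)) N)) ⟩
    (c * d) * expMul (c * d) (rescale c a) N + c * expMul (c * d) (rescale c (shift a)) N
      ≡⟨ cong₂ (λ x y → (c * d) * x + c * y) (rescale-expMul c d a N) (rescale-expMul c d (shift a) N) ⟨
    (c * d) * (pow c N * expMul d a N) + c * (pow c N * expMul d (shift a) N)
      ≡⟨ factor c d (pow c N) (expMul d a N) (expMul d (shift a) N) ⟩
    (c * pow c N) * (d * expMul d a N + expMul d (shift a) N) ∎)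
    where
    factor : ∀ c d p x y → (c * d) * (p * x) + c * (p * y) ≡ (c * p) * (d * x + y)
    factor = solve-∀ ℚ-ring

  geomSum : ℕ → ℚ → Seq → Seq
  geomSum n c a N = sumBelow n (λ j → expMul (ℕ→ℚ j * c) a N)

  geomSum-telescope : ∀ n c (a : Seq) N →
                      expMul c (geomSum n c a) N - geomSum n c a N ≡ expMul (ℕ→ℚ n * c) a N - a N
  geomSum-telescope n c a N = begin
    expMul c (geomSum n c a) N - geomSum n c a N
      ≡⟨ cong (_- geomSum n c a N) (expMul-sum c n (λ j → expMul (ℕ→ℚ j * c) a) N) ⟩
    sumBelow n (λ j → expMul c (expMul (ℕ→ℚ j * c) a) N) - geomSum n c a N
      ≡⟨ cong (_- geomSum n c a N) (sum-cong n _ _ (λ j _ → next-power j)) ⟩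
    sumBelow n (λ j → expMul (ℕ→ℚ (suc j) * c) a N) - geomSum n c a N
      ≡⟨ sum-telescope n (λ j → expMul (ℕ→ℚ j * c) a N) ⟩
    expMul (ℕ→ℚ n * c) a N - expMul (0ℚ * c) a N
      ≡⟨ cong (λ e → expMul (ℕ→ℚ n * c) a N - expMul e a N) (*-zeroˡ c) ⟩
    expMul (ℕ→ℚ n * c) a N - expMul 0ℚ a N
      ≡⟨ cong (λ z → expMul (ℕ→ℚ n * c) a N - z) (expMul-0 a N) ⟩
    expMul (ℕ→ℚ n * c) a N - a N ∎
    where
    next-power : ∀ j → expMul c (expMul (ℕ→ℚ j * c) a) N ≡ expMul (ℕ→ℚ (suc j) * c) a N
    next-power j = trans (expMul-expMul c (ℕ→ℚ j * c) a N)
      (cong (λ e → expMul e a N) (trans (collect c (ℕ→ℚ j)) (cong (_* c) (sym (ℕ→ℚ-suc j)))))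
      where
      collect : ∀ c s → c + s * c ≡ (1ℚ + s) * c
      collect = solve-∀ ℚ-ring

  expMul-leading : ∀ c (a : Seq) N → (∀ {k} → k ℕ.< N → a k ≡ 0ℚ) → expMul c a N ≡ a N
  expMul-leading c a zero _ = refl
  expMul-leading c a (suc N) low = begin
    c * expMul c a N + expMul c (shift a) N  ≡⟨ cong₂ (λ x y → c * x + y) (expMul-leading c a N (low ∘′ ℕP.m<n⇒m<1+n))
                                                                        (expMul-leading c (shift a) N (low ∘′ s≤s)) ⟩
    c * a N + a (suc N)                      ≡⟨ cong (λ x → c * x + a (suc N)) (low ℕP.≤-refl) ⟩
    c * 0ℚ + a (suc N)                       ≡⟨ cong (_+ a (suc N)) (*-zeroʳ c) ⟩
    0ℚ + a (suc N)                           ≡⟨ +-identityˡ (a (suc N)) ⟩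
    a (suc N)                                ∎

  expMul-subleading : ∀ c (a : Seq) N → (∀ {k} → k ℕ.< N → a k ≡ 0ℚ) →
                      expMul c a (suc N) ≡ (ℕ→ℚ (suc N) * c) * a N + a (suc N)
  expMul-subleading c a zero _ = unit c (a 0) (a 1)
    where
    unit : ∀ c x y → c * x + y ≡ (1ℚ * c) * x + y
    unit = solve-∀ ℚ-ring
  expMul-subleading c a (suc K) low
    rewrite expMul-leading c a (suc K) low | expMul-subleading c (shift a) K (low ∘′ s≤s) | ℕ→ℚ-suc (suc K) =
    collect c (ℕ→ℚ (suc K)) (a (suc K)) (a (suc (suc K)))
    where
    collect : ∀ c s x y → c * x + (s * c * x + y) ≡ (1ℚ + s) * c * x + y
    collect = solve-∀ ℚ-ring

  -- (e^t + 1)·A = 0 forces A = 0: the lowest nonzero coefficient would satisfy 2a_N = 0.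
  e^t+1-cancel₀ : ∀ (a : Seq) → (∀ N → expMul 1ℚ a N + a N ≡ 0ℚ) → ∀ N → a N ≡ 0ℚ
  e^t+1-cancel₀ a vanish = <-rec _ λ N low →
    double-zero (a N) (trans (cong (_+ a N) (sym (expMul-leading 1ℚ a N low))) (vanish N))

  -- (e^{ct} - 1)·A = 0 with c ≠ 0 forces A = 0: the lowest nonzero coefficient
  -- would satisfy (N+1)c·a_N = 0.
  e^ct-1-cancel₀ : ∀ c (a : Seq) → c ≢ 0ℚ → (∀ N → expMul c a N - a N ≡ 0ℚ) → ∀ N → a N ≡ 0ℚ
  e^ct-1-cancel₀ c a c≢0 vanish = <-rec _ λ N low →
    zero-product c (a N) c≢0 (zero-product (ℕ→ℚ (suc N)) (c * a N) (ℕ→ℚ-suc≢0 N) (begin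
      ℕ→ℚ (suc N) * (c * a N)                             ≡⟨ rearrange (ℕ→ℚ (suc N)) c (a N) (a (suc N)) ⟩
      ((ℕ→ℚ (suc N) * c) * a N + a (suc N)) - a (suc N)  ≡⟨ cong (_- a (suc N)) (expMul-subleading c a N low) ⟨
      expMul c a (suc N) - a (suc N)                      ≡⟨ vanish (suc N) ⟩
      0ℚ                                                  ∎))
    where
    rearrange : ∀ s c x y → s * (c * x) ≡ ((s * c) * x + y) - y
    rearrange = solve-∀ ℚ-ring

  e^t+1-cancel : ∀ (a b : Seq) → (∀ N → expMul 1ℚ a N + a N ≡ expMul 1ℚ b N + b N) → ∀ N → a N ≡ b N
  e^t+1-cancel a b eq N = x∙y⁻¹≈ε⇒x≈y (a N) (b N) (e^t+1-cancel₀ (λ k → a k - b k) difference N)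
    where
    difference : ∀ N → expMul 1ℚ (λ k → a k - b k) N + (a N - b N) ≡ 0ℚ
    difference N = begin
      expMul 1ℚ (λ k → a k - b k) N + (a N - b N)                ≡⟨ cong (_+ (a N - b N)) (expMul-- 1ℚ a b N) ⟩
      (expMul 1ℚ a N - expMul 1ℚ b N) + (a N - b N)              ≡⟨ regroup (expMul 1ℚ a N) (a N) (expMul 1ℚ b N) (b N) ⟩
      (expMul 1ℚ a N + a N) - (expMul 1ℚ b N + b N)              ≡⟨ cong (_- (expMul 1ℚ b N + b N)) (eq N) ⟩
      (expMul 1ℚ b N + b N) - (expMul 1ℚ b N + b N)              ≡⟨ +-inverseʳ (expMul 1ℚ b N + b N) ⟩
      0ℚ                                                          ∎
      where
      regroup : ∀ x y u v → (x - u) + (y - v) ≡ (x + y) - (u + v)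
      regroup = solve-∀ ℚ-ring

  e^ct-1-cancel : ∀ c (a b : Seq) → c ≢ 0ℚ → (∀ N → expMul c a N - a N ≡ expMul c b N - b N) → ∀ N → a N ≡ b N
  e^ct-1-cancel c a b c≢0 eq N = x∙y⁻¹≈ε⇒x≈y (a N) (b N) (e^ct-1-cancel₀ c (λ k → a k - b k) c≢0 difference N)
    where
    difference : ∀ N → expMul c (λ k → a k - b k) N - (a N - b N) ≡ 0ℚ
    difference N = begin
      expMul c (λ k → a k - b k) N - (a N - b N)                 ≡⟨ cong (_- (a N - b N)) (expMul-- c a b N) ⟩
      (expMul c a N - expMul c b N) - (a N - b N)                ≡⟨ regroup (expMul c a N) (a N) (expMul c b N) (b N) ⟩
      (expMul c a N - a N) - (expMul c b N - b N)                ≡⟨ cong (_- (expMul c b N - b N)) (eq N) ⟩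
      (expMul c b N - b N) - (expMul c b N - b N)                ≡⟨ +-inverseʳ (expMul c b N - b N) ⟩
      0ℚ                                                          ∎
      where
      regroup : ∀ x y u v → (x - u) - (y - v) ≡ (x - y) - (u - v)
      regroup = solve-∀ ℚ-ring

  expMul-1-sum : ∀ (a : Seq) N → expMul 1ℚ a N ≡ sumBelow (suc N) (λ k → ℕ→ℚ (N C k) * a k)
  expMul-1-sum a N = trans (expMul-binomial 1ℚ a N) (sum-cong (suc N) _ _ λ k _ →
    cong (_* a k) (trans (cong (ℕ→ℚ (N C k) *_) (pow-1ℚ (N ∸ k))) (*-identityʳ (ℕ→ℚ (N C k)))))

  nth-++ˡ : ∀ i (xs ys : List ℚ) → i ℕ.< length xs → nth i (xs ++ ys) ≡ nth i xs
  nth-++ˡ zero (x ∷ xs) ys _ = refl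
  nth-++ˡ (suc i) (x ∷ xs) ys (s≤s i<n) = nth-++ˡ i xs ys i<n

  nth-last : ∀ (xs : List ℚ) y → nth (length xs) (xs ++ [ y ]) ≡ y
  nth-last [] y = refl
  nth-last (x ∷ xs) y = nth-last xs y

  wsum-snoc : ∀ N k (xs : List ℚ) y → wsum N k (xs ++ [ y ]) ≡ wsum N k xs + ℕ→ℚ (N C (k ℕ.+ length xs)) * y
  wsum-snoc N k [] y = begin
    ℕ→ℚ (N C k) * y + 0ℚ           ≡⟨ +-identityʳ _ ⟩
    ℕ→ℚ (N C k) * y                ≡⟨ cong (λ j → ℕ→ℚ (N C j) * y) (ℕP.+-identityʳ k) ⟨
    ℕ→ℚ (N C (k ℕ.+ 0)) * y        ≡⟨ +-identityˡ _ ⟨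
    0ℚ + ℕ→ℚ (N C (k ℕ.+ 0)) * y   ∎
  wsum-snoc N k (x ∷ xs) y = begin
    ℕ→ℚ (N C k) * x + wsum N (suc k) (xs ++ [ y ])
      ≡⟨ cong (ℕ→ℚ (N C k) * x +_) (wsum-snoc N (suc k) xs y) ⟩
    ℕ→ℚ (N C k) * x + (wsum N (suc k) xs + ℕ→ℚ (N C (suc k ℕ.+ length xs)) * y)
      ≡⟨ +-assoc (ℕ→ℚ (N C k) * x) (wsum N (suc k) xs) _ ⟨
    wsum N k (x ∷ xs) + ℕ→ℚ (N C (suc k ℕ.+ length xs)) * y
      ≡⟨ cong (λ j → wsum N k (x ∷ xs) + ℕ→ℚ (N C j) * y) (ℕP.+-suc k (length xs)) ⟨
    wsum N k (x ∷ xs) + ℕ→ℚ (N C (k ℕ.+ suc (length xs))) * y ∎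

  module SnocFamily (L : ℕ → List ℚ) (v : Seq) (L-zero : L 0 ≡ [ v 0 ])
                    (L-suc : ∀ m → L (suc m) ≡ L m ++ [ v (suc m) ]) where

    length-L : ∀ m → length (L m) ≡ suc m
    length-L zero rewrite L-zero = refl
    length-L (suc m) rewrite L-suc m | ListP.length-++ (L m) {[ v (suc m) ]} | length-L m = ℕP.+-comm (suc m) 1

    nth-L : ∀ m i → i ℕ.≤ m → nth i (L m) ≡ v i
    nth-L zero zero _ rewrite L-zero = refl
    nth-L (suc m) i i≤1+m with ℕP.m≤n⇒m<n∨m≡n i≤1+m
    ... | inj₁ (s≤s i≤m) rewrite L-suc m =
      trans (nth-++ˡ i (L m) _ (subst (i ℕ.<_) (sym (length-L m)) (s≤s i≤m))) (nth-L m i i≤m)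
    ... | inj₂ refl rewrite L-suc m =
      trans (cong (λ j → nth j (L m ++ [ v (suc m) ])) (sym (length-L m))) (nth-last (L m) (v (suc m)))

    wsum-L : ∀ N m → wsum N 0 (L m) ≡ sumBelow (suc m) (λ k → ℕ→ℚ (N C k) * v k)
    wsum-L N zero rewrite L-zero = trans (+-identityʳ (ℕ→ℚ (N C 0) * v 0)) (sym (+-identityˡ (ℕ→ℚ (N C 0) * v 0)))
    wsum-L N (suc m) rewrite L-suc m =
      trans (wsum-snoc N 0 (L m) (v (suc m)))
            (cong₂ _+_ (wsum-L N m) (cong (λ j → ℕ→ℚ (N C j) * v (suc m)) (length-L m)))

  sum-top : ∀ N (a : Seq) → sumBelow (suc N) (λ k → ℕ→ℚ (N C k) * a k) ≡ sumBelow N (λ k → ℕ→ℚ (N C k) * a k) + a N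
  sum-top N a = begin
    S + ℕ→ℚ (N C N) * a N  ≡⟨ cong (λ c → S + ℕ→ℚ c * a N) (nCn≡1 N) ⟩
    S + 1ℚ * a N           ≡⟨ cong (S +_) (*-identityˡ (a N)) ⟩
    S + a N                ∎
    where
    S = sumBelow N (λ k → ℕ→ℚ (N C k) * a k)

  C[1+m,m] : ∀ m → suc m C m ≡ suc m
  C[1+m,m] m = trans (nCk≡nC[n∸k] (ℕP.n≤1+n m)) (trans (cong (suc m C_) (ℕP.m+n∸n≡m 1 m)) (nC1≡n (suc m)))

  bernoulli-recurrence : ∀ N → expMul 1ℚ bernoulli N - bernoulli N ≡ tMul one N
  bernoulli-recurrence N = begin
    expMul 1ℚ bernoulli N - bernoulli N
      ≡⟨ cong (_- bernoulli N) (trans (expMul-1-sum bernoulli N) (sum-top N bernoulli)) ⟩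
    sumBelow N (λ k → ℕ→ℚ (N C k) * bernoulli k) + bernoulli N - bernoulli N
      ≡⟨ +-cancelʳ-sub (sumBelow N (λ k → ℕ→ℚ (N C k) * bernoulli k)) (bernoulli N) ⟩
    sumBelow N (λ k → ℕ→ℚ (N C k) * bernoulli k)
      ≡⟨ lower-sum N ⟩
    tMul one N ∎
    where
    entry : Seq
    entry zero = 1ℚ
    entry (suc m) = - (recip (suc (suc m)) * wsum (suc (suc m)) 0 (bernoulliUpTo m))

    module L = SnocFamily bernoulliUpTo entry refl (λ _ → refl)

    bernoulli-entry : ∀ i → bernoulli i ≡ entry i
    bernoulli-entry i = L.nth-L i i ℕP.≤-refl

    +-cancelʳ-sub : ∀ S b → S + b - b ≡ S
    +-cancelʳ-sub = solve-∀ ℚ-ring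

    lower-sum : ∀ N → sumBelow N (λ k → ℕ→ℚ (N C k) * bernoulli k) ≡ tMul one N
    lower-sum zero = refl
    lower-sum (suc zero) = refl
    lower-sum (suc (suc m)) = begin
      sumBelow (suc m) (λ k → ℕ→ℚ (N′ C k) * bernoulli k) + ℕ→ℚ (N′ C suc m) * bernoulli (suc m)
        ≡⟨ cong₂ _+_ (trans (sum-cong (suc m) _ _ (λ k _ → cong (ℕ→ℚ (N′ C k) *_) (bernoulli-entry k))) (sym (L.wsum-L N′ m)))
                     (cong₂ _*_ (cong ℕ→ℚ (C[1+m,m] (suc m))) (bernoulli-entry (suc m))) ⟩
      W + ℕ→ℚ N′ * (- (recip N′ * W))
        ≡⟨ factor W (ℕ→ℚ N′) (recip N′) ⟩
      W * (1ℚ - recip N′ * ℕ→ℚ N′)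
        ≡⟨ cong (λ z → W * (1ℚ - z)) (recip-inverse N′ (s≤s z≤n)) ⟩
      W * (1ℚ - 1ℚ)
        ≡⟨ vanish W (ℕ→ℚ N′) ⟩
      ℕ→ℚ N′ * 0ℚ ∎
      where
      N′ = suc (suc m)
      W = wsum N′ 0 (bernoulliUpTo m)
      factor : ∀ W s r → W + s * (- (r * W)) ≡ W * (1ℚ - r * s)
      factor = solve-∀ ℚ-ring
      vanish : ∀ W s → W * (1ℚ - 1ℚ) ≡ s * 0ℚ
      vanish = solve-∀ ℚ-ring

  two : ℚ
  two = 1ℚ + 1ℚ

  eulerSeries : ℚ → Seq
  eulerSeries x n = eulerPoly n x

  euler-recurrence : ∀ x N → expMul 1ℚ (eulerSeries x) N + eulerSeries x N ≡ two * pow x N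
  euler-recurrence x N = begin
    expMul 1ℚ E N + E N
      ≡⟨ cong (_+ E N) (trans (expMul-1-sum E N) (sum-top N E)) ⟩
    sumBelow N (λ k → ℕ→ℚ (N C k) * E k) + E N + E N
      ≡⟨ with-top N ⟩
    two * pow x N ∎
    where
    E : Seq
    E = eulerSeries x

    entry : Seq
    entry zero = 1ℚ
    entry (suc n) = pow x (suc n) - ½ * wsum (suc n) 0 (eulerPolyUpTo n x)

    module L = SnocFamily (λ n → eulerPolyUpTo n x) entry refl (λ _ → refl)

    euler-entry : ∀ i → E i ≡ entry i
    euler-entry i = L.nth-L i i ℕP.≤-refl

    with-top : ∀ N → sumBelow N (λ k → ℕ→ℚ (N C k) * E k) + E N + E N ≡ two * pow x N
    with-top zero = refl
    with-top (suc n) = begin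
      sumBelow (suc n) (λ k → ℕ→ℚ (suc n C k) * E k) + E (suc n) + E (suc n)
        ≡⟨ cong₂ (λ S e → S + e + e)
                 (trans (sum-cong (suc n) _ _ (λ k _ → cong (ℕ→ℚ (suc n C k) *_) (euler-entry k))) (sym (L.wsum-L (suc n) n)))
                 (euler-entry (suc n)) ⟩
      W + (pow x (suc n) - ½ * W) + (pow x (suc n) - ½ * W)
        ≡⟨ halves W (pow x (suc n)) ⟩
      two * pow x (suc n) ∎
      where
      W = wsum (suc n) 0 (eulerPolyUpTo n x)
      halves : ∀ W X → W + (X - ½ * W) + (X - ½ * W) ≡ (1ℚ + 1ℚ) * X
      halves = solve-∀ ℚ-ring

  third twoThirds fourThirds fiveThirds sixth : ℚ
  third = ℤ.+ 1 / 3
  twoThirds = ℤ.+ 2 / 3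
  fourThirds = ℤ.+ 4 / 3
  fiveThirds = ℤ.+ 5 / 3
  sixth = ℤ.+ 1 / 6

  rescale-t : ∀ c N → rescale c (tMul one) N ≡ c * tMul one N
  rescale-t c zero = trans (*-zeroʳ 1ℚ) (sym (*-zeroʳ c))
  rescale-t c (suc zero) = cong (_* tMul one 1) (*-identityʳ c)
  rescale-t c (suc (suc K)) = trans (cong (pow c (suc (suc K)) *_) t-coefficient)
    (trans (*-zeroʳ (pow c (suc (suc K)))) (trans (sym (*-zeroʳ c)) (cong (c *_) (sym t-coefficient))))
    where
    t-coefficient : tMul one (suc (suc K)) ≡ 0ℚ
    t-coefficient = *-zeroʳ (ℕ→ℚ (suc (suc K)))

  factor-out : ∀ p x y → p * x - p * y ≡ p * (x - y)
  factor-out = solve-∀ ℚ-ring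

  bernoulli-rescaled : ∀ c N → expMul c (rescale c bernoulli) N - rescale c bernoulli N ≡ c * tMul one N
  bernoulli-rescaled c N = begin
    expMul c (rescale c bernoulli) N - rescale c bernoulli N
      ≡⟨ cong (λ e → expMul e (rescale c bernoulli) N - rescale c bernoulli N) (*-identityʳ c) ⟨
    expMul (c * 1ℚ) (rescale c bernoulli) N - rescale c bernoulli N
      ≡⟨ cong (_- rescale c bernoulli N) (rescale-expMul c 1ℚ bernoulli N) ⟨
    pow c N * expMul 1ℚ bernoulli N - pow c N * bernoulli N
      ≡⟨ factor-out (pow c N) (expMul 1ℚ bernoulli N) (bernoulli N) ⟩
    pow c N * (expMul 1ℚ bernoulli N - bernoulli N)
      ≡⟨ cong (pow c N *_) (bernoulli-recurrence N) ⟩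
    rescale c (tMul one) N
      ≡⟨ rescale-t c N ⟩
    c * tMul one N ∎

  bernoulli₂ : Seq
  bernoulli₂ = rescale two bernoulli

  -- Both sides times
  -- e^{ct} - 1 equal ct, since (e^{ct} - 1)(1 + ⋯ + e^{(n-1)ct}) = e^{2t} - 1.
  bernoulli-multiplication : ∀ n c r → ℕ→ℚ n * c ≡ two → r * two ≡ c → c ≢ 0ℚ →
                             ∀ N → rescale c bernoulli N ≡ r * geomSum n c bernoulli₂ N
  bernoulli-multiplication n c r nc≡2 2r≡c c≢0 =
    e^ct-1-cancel c (rescale c bernoulli) (λ k → r * G k) c≢0 (λ N → trans (bernoulli-rescaled c N) (sym (scaled-sum N)))
    where
    G : Seq
    G = geomSum n c bernoulli₂
    scaled-sum : ∀ N → expMul c (λ k → r * G k) N - r * G N ≡ c * tMul one N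
    scaled-sum N = begin
      expMul c (λ k → r * G k) N - r * G N     ≡⟨ cong (_- r * G N) (expMul-scale c r G N) ⟩
      r * expMul c G N - r * G N               ≡⟨ factor-out r (expMul c G N) (G N) ⟩
      r * (expMul c G N - G N)                 ≡⟨ cong (r *_) (geomSum-telescope n c bernoulli₂ N) ⟩
      r * (expMul (ℕ→ℚ n * c) bernoulli₂ N - bernoulli₂ N)
        ≡⟨ cong (λ e → r * (expMul e bernoulli₂ N - bernoulli₂ N)) nc≡2 ⟩
      r * (expMul two bernoulli₂ N - bernoulli₂ N)   ≡⟨ cong (r *_) (bernoulli-rescaled two N) ⟩
      r * (two * tMul one N)                   ≡⟨ *-assoc r two (tMul one N) ⟨
      (r * two) * tMul one N                   ≡⟨ cong (_* tMul one N) 2r≡c ⟩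
      c * tMul one N                           ∎

  bernoulli-via-halves : ∀ N → bernoulli N ≡ ½ * (bernoulli₂ N + expMul 1ℚ bernoulli₂ N)
  bernoulli-via-halves N = begin
    bernoulli N                        ≡⟨ *-identityˡ (bernoulli N) ⟨
    1ℚ * bernoulli N                   ≡⟨ cong (_* bernoulli N) (pow-1ℚ N) ⟨
    rescale 1ℚ bernoulli N             ≡⟨ bernoulli-multiplication 2 1ℚ ½ refl refl (λ ()) N ⟩
    ½ * ((0ℚ + expMul 0ℚ bernoulli₂ N) + expMul 1ℚ bernoulli₂ N)
      ≡⟨ cong (λ z → ½ * (z + expMul 1ℚ bernoulli₂ N)) (trans (+-identityˡ _) (expMul-0 bernoulli₂ N)) ⟩
    ½ * (bernoulli₂ N + expMul 1ℚ bernoulli₂ N) ∎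

  bernoulli-via-thirds : ∀ N → rescale twoThirds bernoulli N
                               ≡ third * (bernoulli₂ N + expMul twoThirds bernoulli₂ N + expMul fourThirds bernoulli₂ N)
  bernoulli-via-thirds N = trans (bernoulli-multiplication 3 twoThirds third refl refl (λ ()) N)
    (cong (λ z → third * (z + expMul twoThirds bernoulli₂ N + expMul fourThirds bernoulli₂ N))
          (trans (+-identityˡ _) (expMul-0 bernoulli₂ N)))

  bernoulli-via-sixths : ∀ N → rescale third bernoulli N
                               ≡ sixth * (bernoulli₂ N + expMul third bernoulli₂ N + expMul twoThirds bernoulli₂ N
                                          + expMul 1ℚ bernoulli₂ N + expMul fourThirds bernoulli₂ N + expMul fiveThirds bernoulli₂ N)
  bernoulli-via-sixths N = trans (bernoulli-multiplication 6 third sixth refl refl (λ ()) N)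
    (cong (λ z → sixth * (z + expMul third bernoulli₂ N + expMul twoThirds bernoulli₂ N
                            + expMul 1ℚ bernoulli₂ N + expMul fourThirds bernoulli₂ N + expMul fiveThirds bernoulli₂ N))
          (trans (+-identityˡ _) (expMul-0 bernoulli₂ N)))

  expMul-cancel : ∀ (a : Seq) N → expMul 1ℚ (expMul (- 1ℚ) a) N ≡ a N
  expMul-cancel a N = trans (expMul-expMul 1ℚ (- 1ℚ) a N) (expMul-0 a N)

  expMul-pow : ∀ c d N → expMul c (pow d) N ≡ pow (c + d) N
  expMul-pow c d N = begin
    expMul c (pow d) N            ≡⟨ expMul-cong c _ _ (expMul-one d) N ⟨
    expMul c (expMul d one) N     ≡⟨ expMul-expMul c d one N ⟩
    expMul (c + d) one N          ≡⟨ expMul-one (c + d) N ⟩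
    pow (c + d) N                 ∎

  -- B(-t) = e^t·B(t): both sides times e^t - 1 equal e^t·t.
  bernoulli-reflection : ∀ N → rescale (- 1ℚ) bernoulli N ≡ expMul 1ℚ bernoulli N
  bernoulli-reflection = e^ct-1-cancel 1ℚ X (expMul 1ℚ bernoulli) (λ ()) λ N → begin
    expMul 1ℚ X N - X N
      ≡⟨ cong (λ z → expMul 1ℚ X N - z) (expMul-cancel X N) ⟨
    expMul 1ℚ X N - expMul 1ℚ (expMul (- 1ℚ) X) N
      ≡⟨ negate (expMul 1ℚ X N) (expMul 1ℚ (expMul (- 1ℚ) X) N) ⟩
    - 1ℚ * (expMul 1ℚ (expMul (- 1ℚ) X) N - expMul 1ℚ X N)
      ≡⟨ cong (- 1ℚ *_) (expMul-- 1ℚ (expMul (- 1ℚ) X) X N) ⟨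
    - 1ℚ * expMul 1ℚ (λ k → expMul (- 1ℚ) X k - X k) N
      ≡⟨ cong (- 1ℚ *_) (expMul-cong 1ℚ _ _ (bernoulli-rescaled (- 1ℚ)) N) ⟩
    - 1ℚ * expMul 1ℚ (λ k → - 1ℚ * tMul one k) N
      ≡⟨ cong (- 1ℚ *_) (expMul-scale 1ℚ (- 1ℚ) (tMul one) N) ⟩
    - 1ℚ * (- 1ℚ * expMul 1ℚ (tMul one) N)
      ≡⟨ sign-squared (expMul 1ℚ (tMul one) N) ⟩
    expMul 1ℚ (tMul one) N
      ≡⟨ expMul-cong 1ℚ _ _ bernoulli-recurrence N ⟨
    expMul 1ℚ (λ k → expMul 1ℚ bernoulli k - bernoulli k) N
      ≡⟨ expMul-- 1ℚ (expMul 1ℚ bernoulli) bernoulli N ⟩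
    expMul 1ℚ (expMul 1ℚ bernoulli) N - expMul 1ℚ bernoulli N ∎
    where
    X : Seq
    X = rescale (- 1ℚ) bernoulli
    negate : ∀ x y → x - y ≡ - 1ℚ * (y - x)
    negate = solve-∀ ℚ-ring
    sign-squared : ∀ x → - 1ℚ * (- 1ℚ * x) ≡ x
    sign-squared = solve-∀ ℚ-ring

  bernoulli₂-reflection : ∀ c N → rescale (- 1ℚ) (expMul c bernoulli₂) N ≡ expMul (- 1ℚ * c + two) bernoulli₂ N
  bernoulli₂-reflection c N = begin
    rescale (- 1ℚ) (expMul c bernoulli₂) N         ≡⟨ rescale-expMul (- 1ℚ) c bernoulli₂ N ⟩
    expMul (- 1ℚ * c) (rescale (- 1ℚ) bernoulli₂) N ≡⟨ expMul-cong (- 1ℚ * c) _ _ reflected N ⟩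
    expMul (- 1ℚ * c) (expMul two bernoulli₂) N     ≡⟨ expMul-expMul (- 1ℚ * c) two bernoulli₂ N ⟩
    expMul (- 1ℚ * c + two) bernoulli₂ N            ∎
    where
    swap : ∀ a b c → a * (b * c) ≡ b * (a * c)
    swap = solve-∀ ℚ-ring
    reflected : ∀ k → rescale (- 1ℚ) bernoulli₂ k ≡ expMul two bernoulli₂ k
    reflected k = begin
      pow (- 1ℚ) k * (pow two k * bernoulli k)   ≡⟨ swap (pow (- 1ℚ) k) (pow two k) (bernoulli k) ⟩
      pow two k * rescale (- 1ℚ) bernoulli k     ≡⟨ cong (pow two k *_) (bernoulli-reflection k) ⟩
      rescale two (expMul 1ℚ bernoulli) k        ≡⟨ rescale-expMul two 1ℚ bernoulli k ⟩
      expMul two bernoulli₂ k                    ∎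

  -- t·E_{1/3}(t) = (e^{4t/3} - e^{t/3})·B(2t): times e^t + 1 both sides equal
  -- 2t·e^{t/3}, since (e^t + 1)(e^{4t/3} - e^{t/3}) = e^{t/3}(e^{2t} - 1).
  t-euler-third : ∀ N → tMul (eulerSeries third) N ≡ expMul fourThirds bernoulli₂ N - expMul third bernoulli₂ N
  t-euler-third = e^t+1-cancel (tMul E) P λ N → trans (lhs N) (sym (rhs N))
    where
    E P : Seq
    E = eulerSeries third
    P k = expMul fourThirds bernoulli₂ k - expMul third bernoulli₂ k

    lhs : ∀ N → expMul 1ℚ (tMul E) N + tMul E N ≡ two * tMul (pow third) N
    lhs N = begin
      expMul 1ℚ (tMul E) N + tMul E N             ≡⟨ cong (_+ tMul E N) (expMul-tMul 1ℚ E N) ⟩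
      tMul (expMul 1ℚ E) N + tMul E N             ≡⟨ tMul-+ (expMul 1ℚ E) E N ⟨
      tMul (λ k → expMul 1ℚ E k + E k) N          ≡⟨ tMul-cong _ _ (euler-recurrence third) N ⟩
      tMul (λ k → two * pow third k) N            ≡⟨ tMul-scale two (pow third) N ⟩
      two * tMul (pow third) N                    ∎

    telescope : ∀ a b c → (a - b) + (b - c) ≡ a - c
    telescope = solve-∀ ℚ-ring

    rhs : ∀ N → expMul 1ℚ P N + P N ≡ two * tMul (pow third) N
    rhs N = begin
      expMul 1ℚ P N + P N
        ≡⟨ cong (_+ P N) (trans (expMul-- 1ℚ (expMul fourThirds bernoulli₂) (expMul third bernoulli₂) N)
                                (cong₂ _-_ (expMul-expMul 1ℚ fourThirds bernoulli₂ N) (expMul-expMul 1ℚ third bernoulli₂ N))) ⟩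
      (expMul (1ℚ + fourThirds) bernoulli₂ N - expMul fourThirds bernoulli₂ N) + P N
        ≡⟨ telescope (expMul (1ℚ + fourThirds) bernoulli₂ N) (expMul fourThirds bernoulli₂ N) (expMul third bernoulli₂ N) ⟩
      expMul (third + two) bernoulli₂ N - expMul third bernoulli₂ N
        ≡⟨ cong (_- expMul third bernoulli₂ N) (expMul-expMul third two bernoulli₂ N) ⟨
      expMul third (expMul two bernoulli₂) N - expMul third bernoulli₂ N
        ≡⟨ expMul-- third (expMul two bernoulli₂) bernoulli₂ N ⟨
      expMul third (λ k → expMul two bernoulli₂ k - bernoulli₂ k) N
        ≡⟨ expMul-cong third _ _ (bernoulli-rescaled two) N ⟩
      expMul third (λ k → two * tMul one k) N
        ≡⟨ expMul-scale third two (tMul one) N ⟩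
      two * expMul third (tMul one) N
        ≡⟨ cong (two *_) (trans (expMul-tMul third one N) (tMul-cong _ _ (expMul-one third) N)) ⟩
      two * tMul (pow third) N ∎

  t-euler-third-reflected : ∀ N → pow (- 1ℚ) N * tMul (eulerSeries third) N
                                  ≡ expMul twoThirds bernoulli₂ N - expMul fiveThirds bernoulli₂ N
  t-euler-third-reflected N = begin
    pow (- 1ℚ) N * tMul (eulerSeries third) N
      ≡⟨ cong (pow (- 1ℚ) N *_) (t-euler-third N) ⟩
    pow (- 1ℚ) N * (expMul fourThirds bernoulli₂ N - expMul third bernoulli₂ N)
      ≡⟨ factor-out (pow (- 1ℚ) N) (expMul fourThirds bernoulli₂ N) (expMul third bernoulli₂ N) ⟨
    rescale (- 1ℚ) (expMul fourThirds bernoulli₂) N - rescale (- 1ℚ) (expMul third bernoulli₂) N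
      ≡⟨ cong₂ _-_ (bernoulli₂-reflection fourThirds N) (bernoulli₂-reflection third N) ⟩
    expMul twoThirds bernoulli₂ N - expMul fiveThirds bernoulli₂ N ∎

  -- E_{1/2}(-t) = E_{1/2}(t): both solve (e^t + 1)Y = 2e^{t/2}.
  euler-half-symmetric : ∀ N → rescale (- 1ℚ) (eulerSeries ½) N ≡ eulerSeries ½ N
  euler-half-symmetric = e^t+1-cancel Y E λ N → begin
    expMul 1ℚ Y N + Y N                           ≡⟨ +-comm (expMul 1ℚ Y N) (Y N) ⟩
    Y N + expMul 1ℚ Y N                           ≡⟨ cong (_+ expMul 1ℚ Y N) (expMul-cancel Y N) ⟨
    expMul 1ℚ (expMul (- 1ℚ) Y) N + expMul 1ℚ Y N ≡⟨ expMul-+ 1ℚ (expMul (- 1ℚ) Y) Y N ⟨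
    expMul 1ℚ (λ k → expMul (- 1ℚ) Y k + Y k) N   ≡⟨ expMul-cong 1ℚ _ _ reflected-recurrence N ⟩
    expMul 1ℚ (λ k → two * pow (- ½) k) N         ≡⟨ expMul-scale 1ℚ two (pow (- ½)) N ⟩
    two * expMul 1ℚ (pow (- ½)) N                 ≡⟨ cong (two *_) (expMul-pow 1ℚ (- ½) N) ⟩
    two * pow ½ N                                 ≡⟨ euler-recurrence ½ N ⟨
    expMul 1ℚ E N + E N                           ∎
    where
    E Y : Seq
    E = eulerSeries ½
    Y = rescale (- 1ℚ) E
    swap : ∀ a b c → a * (b * c) ≡ b * (a * c)
    swap = solve-∀ ℚ-ring
    reflected-recurrence : ∀ k → expMul (- 1ℚ) Y k + Y k ≡ two * pow (- ½) k
    reflected-recurrence k = begin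
      expMul (- 1ℚ) Y k + Y k                         ≡⟨ cong (_+ Y k) (rescale-expMul (- 1ℚ) 1ℚ E k) ⟨
      pow (- 1ℚ) k * expMul 1ℚ E k + pow (- 1ℚ) k * E k ≡⟨ *-distribˡ-+ (pow (- 1ℚ) k) (expMul 1ℚ E k) (E k) ⟨
      pow (- 1ℚ) k * (expMul 1ℚ E k + E k)            ≡⟨ cong (pow (- 1ℚ) k *_) (euler-recurrence ½ k) ⟩
      pow (- 1ℚ) k * (two * pow ½ k)                  ≡⟨ swap (pow (- 1ℚ) k) two (pow ½ k) ⟩
      two * (pow (- 1ℚ) k * pow ½ k)                  ≡⟨ cong (two *_) (pow-* (- 1ℚ) ½ k) ⟨
      two * pow (- ½) k                               ∎

  euler-half-odd : ∀ m → eulerSeries ½ (suc (2 ℕ.* m)) ≡ 0ℚ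
  euler-half-odd m = double-zero x (begin
    x + x                 ≡⟨ as-difference x ⟩
    x - (- 1ℚ) * x        ≡⟨ cong (λ z → x - z) odd-symmetry ⟩
    x - x                 ≡⟨ +-inverseʳ x ⟩
    0ℚ                    ∎)
    where
    x = eulerSeries ½ (suc (2 ℕ.* m))
    as-difference : ∀ x → x + x ≡ x - (- 1ℚ) * x
    as-difference = solve-∀ ℚ-ring
    odd-symmetry : - 1ℚ * x ≡ x
    odd-symmetry = trans (cong (λ z → (- 1ℚ * z) * x) (sym (pow-even m))) (euler-half-symmetric (suc (2 ℕ.* m)))

  -- E_{1/3}(t) = e^{-t/6}·E_{1/2}(t): both solve (e^t + 1)Y = 2e^{t/3}.
  euler-shift : ∀ N → eulerSeries third N ≡ expMul (- sixth) (eulerSeries ½) N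
  euler-shift = e^t+1-cancel (eulerSeries third) (expMul (- sixth) E) λ N → begin
    expMul 1ℚ (eulerSeries third) N + eulerSeries third N
      ≡⟨ euler-recurrence third N ⟩
    two * pow third N
      ≡⟨ cong (two *_) (expMul-pow (- sixth) ½ N) ⟨
    two * expMul (- sixth) (pow ½) N
      ≡⟨ expMul-scale (- sixth) two (pow ½) N ⟨
    expMul (- sixth) (λ k → two * pow ½ k) N
      ≡⟨ expMul-cong (- sixth) _ _ (euler-recurrence ½) N ⟨
    expMul (- sixth) (λ k → expMul 1ℚ E k + E k) N
      ≡⟨ expMul-+ (- sixth) (expMul 1ℚ E) E N ⟩
    expMul (- sixth) (expMul 1ℚ E) N + expMul (- sixth) E N
      ≡⟨ cong (_+ expMul (- sixth) E N) (trans (expMul-expMul (- sixth) 1ℚ E N) (sym (expMul-expMul 1ℚ (- sixth) E N))) ⟩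
    expMul 1ℚ (expMul (- sixth) E) N + expMul (- sixth) E N ∎
    where
    E : Seq
    E = eulerSeries ½

  three : ℚ
  three = ℤ.+ 3 / 1

  -- The left side combines B(2t), B(t), B(2t/3) and B(t/3) at t^N; the
  -- multiplication formulas express all four through e^{jt/3}B(2t), and so does
  -- t·E_{1/3}(t) = ½((e^{4t/3} - e^{t/3}) + (e^{2t/3} - e^{5t/3}))B(2t) at t^N (N even).
  bernoulli-euler-third : ∀ K → pow (- 1ℚ) (suc K) ≡ 1ℚ →
    - (1ℚ - pow third K) * (pow two (suc K) - 1ℚ) * bernoulli (suc K) ≡ tMul (eulerSeries third) (suc K)
  bernoulli-euler-third K even = begin
    - (1ℚ - pow third K) * (pow two N - 1ℚ) * bernoulli N
      ≡⟨ expand (pow third K) (pow two N) (bernoulli N) ⟩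
    combine (bernoulli₂ N) (bernoulli N) ((pow two N * pow third N) * bernoulli N) (rescale third bernoulli N)
      ≡⟨ cong (λ w → combine (bernoulli₂ N) (bernoulli N) (w * bernoulli N) (rescale third bernoulli N)) (pow-* two third N) ⟨
    combine (bernoulli₂ N) (bernoulli N) (rescale twoThirds bernoulli N) (rescale third bernoulli N)
      ≡⟨ cong₃ (combine (bernoulli₂ N)) (bernoulli-via-halves N) (bernoulli-via-thirds N) (bernoulli-via-sixths N) ⟩
    combine (bernoulli₂ N) (½ * (bernoulli₂ N + M 1ℚ))
            (third * (bernoulli₂ N + M twoThirds + M fourThirds))
            (sixth * (bernoulli₂ N + M third + M twoThirds + M 1ℚ + M fourThirds + M fiveThirds))
      ≡⟨ collect (bernoulli₂ N) (M 1ℚ) (M third) (M twoThirds) (M fourThirds) (M fiveThirds) ⟩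
    ½ * ((M fourThirds - M third) + (M twoThirds - M fiveThirds))
      ≡⟨ cong (½ *_) (cong₂ _+_ (t-euler-third N) (trans (sym parity) (t-euler-third-reflected N))) ⟨
    ½ * (tMul (eulerSeries third) N + tMul (eulerSeries third) N)
      ≡⟨ halve (tMul (eulerSeries third) N) ⟩
    tMul (eulerSeries third) N ∎
    where
    N = suc K
    M : ℚ → ℚ
    M c = expMul c bernoulli₂ N

    -- -(u - v - 3w + 3z) with u = 2^N B_N, v = B_N, w = (2/3)^N B_N, z = (1/3)^N B_N.
    combine : ℚ → ℚ → ℚ → ℚ → ℚ
    combine u v w z = - (u - v - three * w + three * z)

    cong₃ : ∀ (f : ℚ → ℚ → ℚ → ℚ) {x x′ y y′ z z′} → x ≡ x′ → y ≡ y′ → z ≡ z′ → f x y z ≡ f x′ y′ z′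
    cong₃ f refl refl refl = refl

    expand : ∀ p P b → - (1ℚ - p) * (P - 1ℚ) * b
                       ≡ - (P * b - b - three * ((P * (third * p)) * b) + three * ((third * p) * b))
    expand = solve-∀ ℚ-ring

    collect : ∀ b m₁ m₁₃ m₂₃ m₄₃ m₅₃ →
      - (b - ½ * (b + m₁) - three * (third * (b + m₂₃ + m₄₃)) + three * (sixth * (b + m₁₃ + m₂₃ + m₁ + m₄₃ + m₅₃)))
        ≡ ½ * ((m₄₃ - m₁₃) + (m₂₃ - m₅₃))
    collect = solve-∀ ℚ-ring

    parity : pow (- 1ℚ) N * tMul (eulerSeries third) N ≡ tMul (eulerSeries third) N
    parity = trans (cong (_* tMul (eulerSeries third) N) even) (*-identityˡ _)

    halve : ∀ x → ½ * (x + x) ≡ x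
    halve = solve-∀ ℚ-ring

  euler-as-half : ∀ k → euler k * recip (2 ℕ.^ k) ≡ eulerSeries ½ k
  euler-as-half k = begin
    (pow (ℕ→ℚ 2) k * E) * recip (2 ℕ.^ k)   ≡⟨ rearrange (pow (ℕ→ℚ 2) k) E (recip (2 ℕ.^ k)) ⟩
    E * (recip (2 ℕ.^ k) * pow (ℕ→ℚ 2) k)   ≡⟨ cong (E *_) (recip-pow-inverse 1 k) ⟩
    E * 1ℚ                                   ≡⟨ *-identityʳ E ⟩
    E                                        ∎
    where
    E = eulerSeries ½ k
    rearrange : ∀ P e r → (P * e) * r ≡ e * (r * P)
    rearrange = solve-∀ ℚ-ring

  theorem-lhs : ∀ n → 0 ℕ.< n →
    (- recip (2 ℕ.* n)) * (1ℚ - recip (3 ℕ.^ (2 ℕ.* n ∸ 1))) * (ℕ→ℚ (2 ℕ.^ (2 ℕ.* n)) - 1ℚ) * bernoulli (2 ℕ.* n)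
      ≡ eulerSeries third (2 ℕ.* n ∸ 1)
  theorem-lhs (suc n) _ = begin
    (- recip N) * (1ℚ - recip (3 ℕ.^ K)) * (ℕ→ℚ (2 ℕ.^ N) - 1ℚ) * bernoulli N
      ≡⟨ cong₂ (λ p P → (- recip N) * (1ℚ - p) * (P - 1ℚ) * bernoulli N) (recip-pow 2 K) (ℕ→ℚ-^ 2 N) ⟩
    (- recip N) * (1ℚ - pow third K) * (pow two N - 1ℚ) * bernoulli N
      ≡⟨ pull-out (recip N) (pow third K) (pow two N) (bernoulli N) ⟩
    recip N * (- (1ℚ - pow third K) * (pow two N - 1ℚ) * bernoulli N)
      ≡⟨ cong (recip N *_) (bernoulli-euler-third K (pow-even (suc n))) ⟩
    recip N * (ℕ→ℚ N * eulerSeries third K)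
      ≡⟨ *-assoc (recip N) (ℕ→ℚ N) (eulerSeries third K) ⟨
    (recip N * ℕ→ℚ N) * eulerSeries third K
      ≡⟨ cong (_* eulerSeries third K) (recip-inverse N (s≤s z≤n)) ⟩
    1ℚ * eulerSeries third K
      ≡⟨ *-identityˡ (eulerSeries third K) ⟩
    eulerSeries third K ∎
    where
    N = 2 ℕ.* suc n
    K = N ∸ 1
    pull-out : ∀ r p P b → (- r) * (1ℚ - p) * (P - 1ℚ) * b ≡ r * (- (1ℚ - p) * (P - 1ℚ) * b)
    pull-out = solve-∀ ℚ-ring

  odd-exponent : ∀ n m → 2 ℕ.* (n ∸ m) ∸ 1 ≡ (2 ℕ.* n ∸ 1) ∸ 2 ℕ.* m
  odd-exponent n m = begin
    2 ℕ.* (n ∸ m) ∸ 1         ≡⟨ cong (_∸ 1) (ℕP.*-distribˡ-∸ 2 n m) ⟩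
    (2 ℕ.* n ∸ 2 ℕ.* m) ∸ 1   ≡⟨ ℕP.∸-+-assoc (2 ℕ.* n) (2 ℕ.* m) 1 ⟩
    2 ℕ.* n ∸ (2 ℕ.* m ℕ.+ 1) ≡⟨ cong (2 ℕ.* n ∸_) (ℕP.+-comm (2 ℕ.* m) 1) ⟩
    2 ℕ.* n ∸ (1 ℕ.+ 2 ℕ.* m) ≡⟨ ℕP.∸-+-assoc (2 ℕ.* n) 1 (2 ℕ.* m) ⟨
    (2 ℕ.* n ∸ 1) ∸ 2 ℕ.* m   ∎

  -- The right-hand side of the theorem is the binomial expansion of
  -- E_{2n-1}(1/3) = e^{-t/6}E_{1/2}(t) at t^{2n-1}, whose odd terms vanish.
  theorem-rhs : ∀ n → 0 ℕ.< n →
    sumBelow n (λ m → ℕ→ℚ ((2 ℕ.* n ∸ 1) C (2 ℕ.* m)) * (euler (2 ℕ.* m) * recip (2 ℕ.^ (2 ℕ.* m)))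
                      * pow (- (ℤ.+ 1 / 6)) (2 ℕ.* (n ∸ m) ∸ 1))
      ≡ eulerSeries third (2 ℕ.* n ∸ 1)
  theorem-rhs (suc n) _ = begin
    sumBelow (suc n) (λ m → ℕ→ℚ (K C (2 ℕ.* m)) * (euler (2 ℕ.* m) * recip (2 ℕ.^ (2 ℕ.* m)))
                            * pow (- sixth) (2 ℕ.* (suc n ∸ m) ∸ 1))
      ≡⟨ sum-cong (suc n) _ _ (λ m _ → even-term m) ⟩
    sumBelow (suc n) (λ m → term (2 ℕ.* m))
      ≡⟨ sum-evens (suc n) term odd-term ⟨
    binomialSum (- sixth) (eulerSeries ½) K
      ≡⟨ expMul-binomial (- sixth) (eulerSeries ½) K ⟨
    expMul (- sixth) (eulerSeries ½) K
      ≡⟨ euler-shift K ⟨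
    eulerSeries third K ∎
    where
    K = 2 ℕ.* suc n ∸ 1
    term : ℕ → ℚ
    term k = ℕ→ℚ (K C k) * pow (- sixth) (K ∸ k) * eulerSeries ½ k

    swap-last : ∀ c e w → c * e * w ≡ c * w * e
    swap-last = solve-∀ ℚ-ring

    even-term : ∀ m → ℕ→ℚ (K C (2 ℕ.* m)) * (euler (2 ℕ.* m) * recip (2 ℕ.^ (2 ℕ.* m)))
                      * pow (- sixth) (2 ℕ.* (suc n ∸ m) ∸ 1) ≡ term (2 ℕ.* m)
    even-term m = trans (cong₂ (λ e w → ℕ→ℚ (K C (2 ℕ.* m)) * e * w)
                               (euler-as-half (2 ℕ.* m)) (cong (pow (- sixth)) (odd-exponent (suc n) m)))
                        (swap-last (ℕ→ℚ (K C (2 ℕ.* m))) (eulerSeries ½ (2 ℕ.* m)) (pow (- sixth) (K ∸ 2 ℕ.* m)))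

    odd-term : ∀ m → term (suc (2 ℕ.* m)) ≡ 0ℚ
    odd-term m = trans (cong (ℕ→ℚ (K C suc (2 ℕ.* m)) * pow (- sixth) (K ∸ suc (2 ℕ.* m)) *_) (euler-half-odd m))
                       (*-zeroʳ (ℕ→ℚ (K C suc (2 ℕ.* m)) * pow (- sixth) (K ∸ suc (2 ℕ.* m))))

open Lemmas using (theorem-lhs; theorem-rhs)
open import Data.Nat using (ℕ; _<_; _*_; _∸_; _^_)
open import Data.Nat.Combinatorics using (_C_)
open import Data.Integer using (+_)
open import Relation.Binary.PropositionalEquality using (_≡_; trans; sym)
open import Data.Rational using (ℚ; 1ℚ; _/_; -_) renaming (_*_ to _*ℚ_; _-_ to _-ℚ_)

theorem5 : (n : ℕ) → 0 < n →
  ((- recip (2 * n)) *ℚ (1ℚ -ℚ recip (3 ^ (2 * n ∸ 1))) *ℚ (ℕ→ℚ (2 ^ (2 * n)) -ℚ 1ℚ) *ℚ bernoulli (2 * n))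
    ≡ sumBelow n (λ m → ℕ→ℚ ((2 * n ∸ 1) C (2 * m)) *ℚ (euler (2 * m) *ℚ recip (2 ^ (2 * m))) *ℚ pow (- ((+ 1) / 6)) (2 * (n ∸ m) ∸ 1))
theorem5 n 0<n = trans (theorem-lhs n 0<n) (sym (theorem-rhs n 0<n))
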